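{- Let $p$ be an odd integer, let $j$ and $i$ be integers, and let $k=(p-1)/2+ip$. Then $$ s_k(\mathcal{T}_p(j)) = s_i(\mathcal{T}_p(j))\,\mathcal{P}_{(p-1)/2}\big((2-j)\,s_k(j)^2\big), $$ and in particular $$ s_k(\mathcal{T}_p(j))\equiv p\, s_i(\mathcal{T}_p(j)) \pmod{(j-2)\,s_k(j)^2}. $$
   Context: For a number $n$, the sequence $(s_k(n))_{k\in\mathbb{Z}}$ is defined by $s_0(n)=1$, $s_1(n)=n+1$ and $s_{k+2}(n)=n\,s_{k+1}(n)-s_k(n)$ for all $k\in\mathbb{Z}$; for each $k$, $s_k(n)$ is a polynomial in $n$ with integer coefficients. The polynomials $\mathcal{P}_k\in\mathbb{Z}[z]$ are defined by $\mathcal{P}_k(z)=s_k(2-z)$. The dilated Chebyshev polynomials of the first kind $\mathcal{T}_k$ are defined by $\mathcal{T}_k(2\cos\theta)=2\cos(k\theta)$; equivalently $\mathcal{T}_0(x)=2$, $\mathcal{T}_1(x)=x$, $\mathcal{T}_{k+2}(x)=x\,\mathcal{T}_{k+1}(x)-\mathcal{T}_k(x)$. -}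

module Defs where

open import Data.Nat using (ℕ; zero; suc)
open import Data.Integer using (ℤ; +_; -[1+_]; _+_; _-_; _*_; -_)
open import Data.Integer.Divisibility using (_∣_)

rec2 : ℤ → ℤ → ℤ → ℕ → ℤ
rec2 a b x zero = a
rec2 a b x (suc zero) = b
rec2 a b x (suc (suc m)) = x * rec2 a b x (suc m) - rec2 a b x m

-- s_k(n), k ∈ ℤ: s₀ = 1, s₁ = n+1, s_{k+2} = n s_{k+1} − s_k for all k ∈ ℤ.
-- For negative indices, t_m = s_{-m} satisfies t₀ = 1, t₁ = -1, t_{m+2} = n t_{m+1} − t_m.
s : ℤ → ℤ → ℤ
s (+ m) n = rec2 (+ 1) (n + + 1) n m
s -[1+ m ] n = rec2 (+ 1) (- + 1) n (suc m)

𝒫 : ℤ → ℤ → ℤ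
𝒫 k z = s k (+ 2 - z)

-- Dilated Chebyshev polynomials of the first kind, evaluated at an integer:
-- 𝒯₀ = 2, 𝒯₁ = x, 𝒯_{k+2} = x 𝒯_{k+1} − 𝒯_k, for all k ∈ ℤ (so 𝒯_{-k} = 𝒯_k).
𝒯 : ℤ → ℤ → ℤ
𝒯 (+ m) x = rec2 (+ 2) x x m
𝒯 -[1+ m ] x = rec2 (+ 2) x x (suc m)

_≡_[mod_] : ℤ → ℤ → ℤ → Set
a ≡ b [mod c ] = c ∣ (a - b)

{-# OPTIONS --safe #-}
module Submission where

-- A sequence f : ℤ → ℤ with f (m + 1) + f (m - 1) = x f m is determined by f 0 and f 1; more
-- generally two such sequences, for x ≡ y (mod c), that agree mod c at 0 and 1 agree mod c
-- everywhere. Comparing initial values yields the addition law f (m + q) + f (m - q) = 𝒯_q(x) f m,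
-- hence 𝒯_a ∘ 𝒯_b = 𝒯_(ab) and, using s_(-1-i) = - s_i, the progression identity
-- s_(i + h(2i+1))(n) = s_i(n) s_h(𝒯_(2i+1)(n)); likewise 𝒯_(2k+1)(x) = 2 + (x - 2) s_k(x)².
-- Since k = h + ip = i + h(2i+1) and (2i+1)p = 2k+1, this is the factorisation, and the
-- congruence follows from s_h(2 + c) ≡ s_h(2) = 2h + 1 (mod c).

open import Defs
open import Data.Integer using (ℤ; +_; _+_; _-_; _*_)
open import Data.Product using (_×_)
open import Relation.Binary.PropositionalEquality using (_≡_)

open import Data.Integer using (-[1+_]; -_; 0ℤ; 1ℤ; -1ℤ)
open import Data.Integer.Divisibility.Signed
  using (_∣_; divides; ∣-refl; ∣m∣n⇒∣m+n; ∣m∣n⇒∣m-n; ∣n⇒∣m*n; ∣m⇒∣m*n; 0∣⇒≡0; ∣⇒∣ᵤ)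
open import Data.Integer.Properties
  using (+-commutativeSemigroup; *-commutativeSemigroup; +-*-ring;
         +-comm; +-assoc; +-identityˡ; +-identityʳ; +-inverseʳ; neg-minus-pos;
         *-comm; *-assoc; *-identityˡ; *-identityʳ; *-zeroˡ; *-distribˡ-+; *-distribʳ-+;
         -1*i≡-i; i≡j⇒i-j≡0; i-j≡0⇒i≡j)
open import Algebra.Properties.CommutativeSemigroup +-commutativeSemigroup using (interchange)
open import Algebra.Properties.CommutativeSemigroup *-commutativeSemigroup using (x∙yz≈y∙xz)
open import Algebra.Properties.Ring +-*-ring using (x≈z//y; //-rightDividesˡ; x[y-z]≈xy-xz)
open import Data.Integer.Tactic.RingSolver using (solve-∀)
open import Data.Nat using (zero; suc)
import Data.Nat.Properties as ℕ
open import Data.Product using (_,_; proj₁; proj₂)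
open import Relation.Binary.PropositionalEquality
  using (refl; sym; trans; cong; cong₂; subst; module ≡-Reasoning)

record Recurrence (x : ℤ) (f : ℤ → ℤ) : Set where
  constructor recurrence
  field holds : ∀ m → f (m + 1ℤ) + f (m - 1ℤ) ≡ x * f m
open Recurrence

ℤ-induction₂ : (P : ℤ → Set) → P 0ℤ → P 1ℤ →
               (∀ m → P (m - 1ℤ) → P m → P (m + 1ℤ)) →
               (∀ m → P (m + 1ℤ) → P m → P (m - 1ℤ)) →
               ∀ m → P m
ℤ-induction₂ P P₀ P₁ up down = λ where
    (+ n)    → proj₁ (upward n)
    -[1+ n ] → proj₂ (downward n)
  where
  upward : ∀ n → P (+ n) × P (+ suc n)
  upward zero    = P₀ , P₁
  upward (suc n) with upward n
  ... | Pn , Pn+1 = Pn+1 , subst P (cong +_ (ℕ.+-comm (suc n) 1)) (up (+ suc n) Pn Pn+1)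

  downward : ∀ n → P (-[1+ n ] + 1ℤ) × P -[1+ n ]
  downward zero    = P₀ , down 0ℤ P₁ P₀
  downward (suc n) with downward n
  ... | P-n , P-n-1 = P-n-1 , subst P (neg-minus-pos n 1) (down -[1+ n ] P-n P-n-1)

module _ {x : ℤ} {f : ℤ → ℤ} (rec : Recurrence x f) where

  recurrence-forward : ∀ m → f (m + 1ℤ) ≡ x * f m - f (m - 1ℤ)
  recurrence-forward m = x≈z//y _ _ _ (holds rec m)

  recurrence-backward : ∀ m → f (m - 1ℤ) ≡ x * f m - f (m + 1ℤ)
  recurrence-backward m = x≈z//y _ _ _ (trans (+-comm (f (m - 1ℤ)) _) (holds rec m))

recurrences-congruent : ∀ {c x y f g} → Recurrence x f → Recurrence y g → c ∣ x - y →
                        c ∣ f 0ℤ - g 0ℤ → c ∣ f 1ℤ - g 1ℤ → ∀ m → c ∣ f m - g m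
recurrences-congruent {c} {x} {y} {f} {g} recf recg c∣x-y c∣f₀-g₀ c∣f₁-g₁ =
  ℤ-induction₂ (λ m → c ∣ f m - g m) c∣f₀-g₀ c∣f₁-g₁
    (λ m c∣prev c∣m → step m (recurrence-forward recf m) (recurrence-forward recg m) c∣m c∣prev)
    (λ m c∣next c∣m → step m (recurrence-backward recf m) (recurrence-backward recg m) c∣m c∣next)
  where
  regroup : ∀ x y u u′ v v′ → x * (u - u′) + (x - y) * u′ - (v - v′) ≡ (x * u - v) - (y * u′ - v′)
  regroup = solve-∀

  step : ∀ m {n n′} → f n′ ≡ x * f m - f n → g n′ ≡ y * g m - g n →
         c ∣ f m - g m → c ∣ f n - g n → c ∣ f n′ - g n′
  step m {n} eqf eqg c∣m c∣n =
    subst (c ∣_) (trans (regroup x y (f m) (g m) (f n) (g n)) (sym (cong₂ _-_ eqf eqg)))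
      (∣m∣n⇒∣m-n (∣m∣n⇒∣m+n (∣n⇒∣m*n x c∣m) (∣m⇒∣m*n (g m) c∣x-y)) c∣n)

recurrences-unique : ∀ {x f g} → Recurrence x f → Recurrence x g →
                     f 0ℤ ≡ g 0ℤ → f 1ℤ ≡ g 1ℤ → ∀ m → f m ≡ g m
recurrences-unique {x} {f} {g} recf recg f₀≡g₀ f₁≡g₁ m =
  i-j≡0⇒i≡j (f m) (g m) (0∣⇒≡0 (recurrences-congruent recf recg
    (i≡j⇒0∣i-j {x} refl) (i≡j⇒0∣i-j f₀≡g₀) (i≡j⇒0∣i-j f₁≡g₁) m))
  where
  i≡j⇒0∣i-j : ∀ {i j} → i ≡ j → 0ℤ ∣ i - j
  i≡j⇒0∣i-j i≡j = subst (0ℤ ∣_) (sym (i≡j⇒i-j≡0 i≡j)) ∣-refl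

module _ {x : ℤ} {f : ℤ → ℤ} (rec : Recurrence x f) where

  recurrence-shift : ∀ c → Recurrence x (λ m → f (c + m))
  recurrence-shift c = recurrence λ m →
      trans (cong₂ _+_ (cong f (sym (+-assoc c m 1ℤ))) (cong f (sym (+-assoc c m -1ℤ))))
          (holds rec (c + m))

  recurrence-reflect : ∀ c → Recurrence x (λ m → f (c - m))
  recurrence-reflect c = recurrence λ m →
    trans (cong₂ _+_ (cong f (reflect₁ c m)) (cong f (reflect₂ c m)))
          (trans (+-comm (f (c - m - 1ℤ)) _) (holds rec (c - m)))
    where
    reflect₁ : ∀ c m → c - (m + 1ℤ) ≡ c - m - 1ℤ
    reflect₁ = solve-∀
    reflect₂ : ∀ c m → c - (m - 1ℤ) ≡ c - m + 1ℤ
    reflect₂ = solve-∀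

  recurrence-*ʳ : ∀ a → Recurrence x (λ m → f m * a)
  recurrence-*ʳ a = recurrence λ m → begin
    f (m + 1ℤ) * a + f (m - 1ℤ) * a  ≡⟨ *-distribʳ-+ a (f (m + 1ℤ)) (f (m - 1ℤ)) ⟨
    (f (m + 1ℤ) + f (m - 1ℤ)) * a    ≡⟨ cong (_* a) (holds rec m) ⟩
    x * f m * a                      ≡⟨ *-assoc x (f m) a ⟩
    x * (f m * a)                    ∎
    where open ≡-Reasoning

  recurrence-*ˡ : ∀ a → Recurrence x (λ m → a * f m)
  recurrence-*ˡ a = recurrence λ m → begin
    a * f (m + 1ℤ) + a * f (m - 1ℤ)  ≡⟨ *-distribˡ-+ a (f (m + 1ℤ)) (f (m - 1ℤ)) ⟨
    a * (f (m + 1ℤ) + f (m - 1ℤ))    ≡⟨ cong (a *_) (holds rec m) ⟩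
    a * (x * f m)                    ≡⟨ x∙yz≈y∙xz a x (f m) ⟩
    x * (a * f m)                    ∎
    where open ≡-Reasoning

module _ {x : ℤ} {f g : ℤ → ℤ} (recf : Recurrence x f) (recg : Recurrence x g) where

  recurrence-+ : Recurrence x (λ m → f m + g m)
  recurrence-+ = recurrence λ m → begin
    f (m + 1ℤ) + g (m + 1ℤ) + (f (m - 1ℤ) + g (m - 1ℤ))
      ≡⟨ interchange (f (m + 1ℤ)) (g (m + 1ℤ)) (f (m - 1ℤ)) (g (m - 1ℤ)) ⟩
    f (m + 1ℤ) + f (m - 1ℤ) + (g (m + 1ℤ) + g (m - 1ℤ))    ≡⟨ cong₂ _+_ (holds recf m) (holds recg m) ⟩
    x * f m + x * g m                                      ≡⟨ *-distribˡ-+ x (f m) (g m) ⟨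
    x * (f m + g m)                                        ∎
    where open ≡-Reasoning

  recurrence-- : Recurrence x (λ m → f m - g m)
  recurrence-- = recurrence λ m → begin
    f (m + 1ℤ) - g (m + 1ℤ) + (f (m - 1ℤ) - g (m - 1ℤ))
      ≡⟨ regroup (f (m + 1ℤ)) (g (m + 1ℤ)) (f (m - 1ℤ)) (g (m - 1ℤ)) ⟩
    f (m + 1ℤ) + f (m - 1ℤ) - (g (m + 1ℤ) + g (m - 1ℤ))    ≡⟨ cong₂ _-_ (holds recf m) (holds recg m) ⟩
    x * f m - x * g m                                      ≡⟨ x[y-z]≈xy-xz x (f m) (g m) ⟨
    x * (f m - g m)                                        ∎
    where
    open ≡-Reasoning
    regroup : ∀ a b c d → a - b + (c - d) ≡ a + c - (b + d)
    regroup = solve-∀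

rec2-recurrence : ∀ {a b b′ x} (F : ℤ → ℤ) →
                  (∀ n → F (+ n) ≡ rec2 a b x n) → (∀ n → F -[1+ n ] ≡ rec2 a b′ x (suc n)) →
                  b + b′ ≡ x * a → Recurrence x F
rec2-recurrence {a} {b} {b′} {x} F F⁺ F⁻ b+b′≡x*a = recurrence λ where
    (+ zero)     → via (F⁺ 1) (F⁻ 0) (F⁺ 0) b+b′≡x*a
    (+ suc n)    → via (trans (cong F (cong +_ (ℕ.+-comm (suc n) 1))) (F⁺ (suc (suc n))))
                       (F⁺ n) (F⁺ (suc n)) (rec2-step b n)
    -[1+ zero ]  → via (F⁺ 0) (F⁻ 1) (F⁻ 0) (trans (+-comm a _) (rec2-step b′ 0))
    -[1+ suc n ] → via (F⁻ n) (trans (cong F (neg-minus-pos (suc n) 1)) (F⁻ (suc (suc n))))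
                       (F⁻ (suc n)) (trans (+-comm (rec2 a b′ x (suc n)) _) (rec2-step b′ (suc n)))
  where
  rec2-step : ∀ b n → rec2 a b x (suc (suc n)) + rec2 a b x n ≡ x * rec2 a b x (suc n)
  rec2-step b n = //-rightDividesˡ (rec2 a b x n) (x * rec2 a b x (suc n))

  via : ∀ {u v w A B C} → F u ≡ A → F v ≡ B → F w ≡ C → A + B ≡ x * C → F u + F v ≡ x * F w
  via refl refl refl A+B≡x*C = A+B≡x*C

s-recurrence : ∀ n → Recurrence n (λ k → s k n)
s-recurrence n = rec2-recurrence (λ k → s k n) (λ _ → refl) (λ _ → refl) (initial n)
  where
  initial : ∀ n → (n + 1ℤ) + - 1ℤ ≡ n * 1ℤ
  initial = solve-∀

𝒯-recurrence : ∀ x → Recurrence x (λ k → 𝒯 k x)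
𝒯-recurrence x = rec2-recurrence (λ k → 𝒯 k x) (λ _ → refl) (λ _ → refl) (initial x)
  where
  initial : ∀ x → x + x ≡ x * + 2
  initial = solve-∀

recurrence-addition : ∀ {x f} → Recurrence x f → ∀ m q → f (m + q) + f (m - q) ≡ 𝒯 q x * f m
recurrence-addition {x} {f} rec m =
  recurrences-unique (recurrence-+ (recurrence-shift rec m) (recurrence-reflect rec m))
                     (recurrence-*ʳ (𝒯-recurrence x) (f m))
                     (trans (cong₂ _+_ (cong f (+-identityʳ m)) (cong f (+-identityʳ m))) (a+a≡2a (f m)))
                     (holds rec m)
  where
  a+a≡2a : ∀ a → a + a ≡ + 2 * a
  a+a≡2a = solve-∀

recurrence-progression : ∀ {x f} → Recurrence x f → ∀ b → Recurrence (𝒯 b x) (λ m → f (m * b))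
recurrence-progression {x} {f} rec b = recurrence λ m →
  trans (cong₂ _+_ (cong f ([m+1]b m b)) (cong f ([m-1]b m b))) (recurrence-addition rec (m * b) b)
  where
  [m+1]b : ∀ m b → (m + 1ℤ) * b ≡ m * b + b
  [m+1]b = solve-∀
  [m-1]b : ∀ m b → (m - 1ℤ) * b ≡ m * b - b
  [m-1]b = solve-∀

𝒯-∘ : ∀ a b x → 𝒯 (a * b) x ≡ 𝒯 a (𝒯 b x)
𝒯-∘ a b x =
  recurrences-unique (recurrence-progression (𝒯-recurrence x) b) (𝒯-recurrence (𝒯 b x))
                     (cong (λ t → 𝒯 t x) (*-zeroˡ b)) (cong (λ t → 𝒯 t x) (*-identityˡ b)) a

recurrence-odd-difference : ∀ {x f} → Recurrence x f → ∀ c a →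
                            f (c + 1ℤ + a) - f (c - a) ≡ s a x * (f (c + 1ℤ) - f c)
recurrence-odd-difference {x} {f} rec c =
  recurrences-unique (recurrence-- (recurrence-shift rec (c + 1ℤ)) (recurrence-reflect rec c))
                     (recurrence-*ʳ (s-recurrence x) (f (c + 1ℤ) - f c))
                     (trans (cong₂ _-_ (cong f (+-identityʳ (c + 1ℤ))) (cong f (+-identityʳ c)))
                            (sym (*-identityˡ _)))
                     at-1
  where
  c+1-1≡c : ∀ c → c + 1ℤ - 1ℤ ≡ c
  c+1-1≡c = solve-∀
  regroup : ∀ x u v → (x * v - u) - (x * u - v) ≡ (x + 1ℤ) * (v - u)
  regroup = solve-∀
  open ≡-Reasoning
  at-1 : f (c + 1ℤ + 1ℤ) - f (c - 1ℤ) ≡ (x + 1ℤ) * (f (c + 1ℤ) - f c)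
  at-1 = begin
    f (c + 1ℤ + 1ℤ) - f (c - 1ℤ)
      ≡⟨ cong₂ _-_ (trans (recurrence-forward rec (c + 1ℤ)) (cong (λ t → x * f (c + 1ℤ) - f t) (c+1-1≡c c)))
                   (recurrence-backward rec c) ⟩
    (x * f (c + 1ℤ) - f c) - (x * f c - f (c + 1ℤ))
      ≡⟨ regroup x (f c) (f (c + 1ℤ)) ⟩
    (x + 1ℤ) * (f (c + 1ℤ) - f c) ∎

𝒯-even : ∀ a x → 𝒯 (- a) x ≡ 𝒯 a x
𝒯-even (+ zero)  x = refl
𝒯-even (+ suc n) x = refl
𝒯-even -[1+ n ]  x = refl

𝒯-difference : ∀ a x → 𝒯 (a + 1ℤ) x - 𝒯 a x ≡ (x - + 2) * s a x
𝒯-difference a x = begin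
  𝒯 (a + 1ℤ) x - 𝒯 a x        ≡⟨ cong₂ (λ u v → 𝒯 u x - v) (+-comm a 1ℤ) (sym (𝒯-even a x)) ⟩
  𝒯 (1ℤ + a) x - 𝒯 (- a) x    ≡⟨ cong (λ t → 𝒯 (1ℤ + a) x - 𝒯 t x) (sym (+-identityˡ (- a))) ⟩
  𝒯 (1ℤ + a) x - 𝒯 (0ℤ - a) x ≡⟨ recurrence-odd-difference (𝒯-recurrence x) 0ℤ a ⟩
  s a x * (x - + 2)           ≡⟨ *-comm (s a x) (x - + 2) ⟩
  (x - + 2) * s a x           ∎
  where open ≡-Reasoning

𝒯-odd : ∀ k x → 𝒯 (k + 1ℤ + k) x ≡ + 2 - (+ 2 - x) * (s k x * s k x)
𝒯-odd k x = begin
  𝒯 (k + 1ℤ + k) x                        ≡⟨ //-rightDividesˡ (+ 2) (𝒯 (k + 1ℤ + k) x) ⟨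
  𝒯 (k + 1ℤ + k) x - + 2 + + 2            ≡⟨ cong (λ t → 𝒯 (k + 1ℤ + k) x - 𝒯 t x + + 2) (+-inverseʳ k) ⟨
  𝒯 (k + 1ℤ + k) x - 𝒯 (k - k) x + + 2    ≡⟨ cong (_+ + 2) (recurrence-odd-difference (𝒯-recurrence x) k k) ⟩
  s k x * (𝒯 (k + 1ℤ) x - 𝒯 k x) + + 2    ≡⟨ cong (λ d → s k x * d + + 2) (𝒯-difference k x) ⟩
  s k x * ((x - + 2) * s k x) + + 2       ≡⟨ regroup x (s k x) ⟩
  + 2 - (+ 2 - x) * (s k x * s k x)       ∎
  where
  open ≡-Reasoning
  regroup : ∀ x u → u * ((x - + 2) * u) + + 2 ≡ + 2 - (+ 2 - x) * (u * u)
  regroup = solve-∀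

s-reflect : ∀ i n → s (-1ℤ - i) n ≡ - s i n
s-reflect i n =
  trans (recurrences-unique (recurrence-reflect (s-recurrence n) -1ℤ) (recurrence-*ˡ (s-recurrence n) -1ℤ)
                            refl (at-1 n) i)
        (-1*i≡-i (s i n))
  where
  at-1 : ∀ n → n * -1ℤ - 1ℤ ≡ -1ℤ * (n + 1ℤ)
  at-1 = solve-∀

s-odd-progression : ∀ n i h → s (i + h * (1ℤ + + 2 * i)) n ≡ s i n * s h (𝒯 (1ℤ + + 2 * i) n)
s-odd-progression n i h =
  recurrences-unique (recurrence-progression (recurrence-shift (s-recurrence n) i) b)
                     (recurrence-*ˡ (s-recurrence (𝒯 b n)) (s i n))
                     at-0 at-1 h
  where
  b = 1ℤ + + 2 * i
  open ≡-Reasoning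
  at-0 : s (i + 0ℤ * b) n ≡ s i n * 1ℤ
  at-0 = begin
    s (i + 0ℤ * b) n ≡⟨ cong (λ t → s (i + t) n) (*-zeroˡ b) ⟩
    s (i + 0ℤ) n     ≡⟨ cong (λ t → s t n) (+-identityʳ i) ⟩
    s i n            ≡⟨ *-identityʳ (s i n) ⟨
    s i n * 1ℤ       ∎
  i-b≡-1-i : ∀ i → i - (1ℤ + + 2 * i) ≡ -1ℤ - i
  i-b≡-1-i = solve-∀
  regroup : ∀ t u → t * u - - u ≡ u * (t + 1ℤ)
  regroup = solve-∀
  at-1 : s (i + 1ℤ * b) n ≡ s i n * (𝒯 b n + 1ℤ)
  at-1 = begin
    s (i + 1ℤ * b) n             ≡⟨ cong (λ t → s (i + t) n) (*-identityˡ b) ⟩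
    s (i + b) n                  ≡⟨ x≈z//y _ _ _ (recurrence-addition (s-recurrence n) i b) ⟩
    𝒯 b n * s i n - s (i - b) n  ≡⟨ cong (λ t → 𝒯 b n * s i n - s t n) (i-b≡-1-i i) ⟩
    𝒯 b n * s i n - s (-1ℤ - i) n ≡⟨ cong (λ t → 𝒯 b n * s i n - t) (s-reflect i n) ⟩
    𝒯 b n * s i n - - s i n      ≡⟨ regroup (𝒯 b n) (s i n) ⟩
    s i n * (𝒯 b n + 1ℤ)         ∎

s-congruence : ∀ c h → c ∣ s h (+ 2 + c) - (1ℤ + + 2 * h)
s-congruence c =
  recurrences-congruent (s-recurrence (+ 2 + c)) odd-recurrence
                        (divides 1ℤ (at-0 c)) (divides 0ℤ refl) (divides 1ℤ (at-1 c))
  where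
  odd-sum : ∀ m → 1ℤ + + 2 * (m + 1ℤ) + (1ℤ + + 2 * (m - 1ℤ)) ≡ + 2 * (1ℤ + + 2 * m)
  odd-sum = solve-∀
  odd-recurrence : Recurrence (+ 2) (λ h → 1ℤ + + 2 * h)
  odd-recurrence = recurrence odd-sum
  at-0 : ∀ c → + 2 + c - + 2 ≡ 1ℤ * c
  at-0 = solve-∀
  at-1 : ∀ c → + 2 + c + 1ℤ - + 3 ≡ 1ℤ * c
  at-1 = solve-∀

𝒯-odd-∘ : ∀ h i x → let k = h + i * (1ℤ + + 2 * h) in
          𝒯 (1ℤ + + 2 * i) (𝒯 (1ℤ + + 2 * h) x) ≡ + 2 - (+ 2 - x) * (s k x * s k x)
𝒯-odd-∘ h i x = begin
  𝒯 (1ℤ + + 2 * i) (𝒯 (1ℤ + + 2 * h) x)   ≡⟨ 𝒯-∘ (1ℤ + + 2 * i) (1ℤ + + 2 * h) x ⟨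
  𝒯 ((1ℤ + + 2 * i) * (1ℤ + + 2 * h)) x   ≡⟨ cong (λ t → 𝒯 t x) (odd-product h i) ⟩
  𝒯 (k + 1ℤ + k) x                        ≡⟨ 𝒯-odd k x ⟩
  + 2 - (+ 2 - x) * (s k x * s k x)       ∎
  where
  open ≡-Reasoning
  k = h + i * (1ℤ + + 2 * h)
  odd-product : ∀ h i → (1ℤ + + 2 * i) * (1ℤ + + 2 * h) ≡ h + i * (1ℤ + + 2 * h) + 1ℤ + (h + i * (1ℤ + + 2 * h))
  odd-product = solve-∀

theorem42 : (p h i j : ℤ) → p ≡ + 1 + + 2 * h →
    let k = h + i * p in
    (s k (𝒯 p j) ≡ s i (𝒯 p j) * 𝒫 h ((+ 2 - j) * (s k j * s k j)))
    × (s k (𝒯 p j) ≡ p * s i (𝒯 p j) [mod (j - + 2) * (s k j * s k j) ])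
theorem42 p h i j refl =
  factorisation , ∣⇒∣ᵤ (subst (c ∣_) (sym difference) (∣n⇒∣m*n (s i N) (s-congruence c h)))
  where
  k = h + i * p
  N = 𝒯 p j
  X = s k j * s k j
  c = (j - + 2) * X
  open ≡-Reasoning
  k≡i+h[1+2i] : ∀ h i → h + i * (1ℤ + + 2 * h) ≡ i + h * (1ℤ + + 2 * i)
  k≡i+h[1+2i] = solve-∀
  factorisation : s k N ≡ s i N * 𝒫 h ((+ 2 - j) * X)
  factorisation = begin
    s k N                                    ≡⟨ cong (λ t → s t N) (k≡i+h[1+2i] h i) ⟩
    s (i + h * (1ℤ + + 2 * i)) N             ≡⟨ s-odd-progression N i h ⟩
    s i N * s h (𝒯 (1ℤ + + 2 * i) N)         ≡⟨ cong (λ t → s i N * s h t) (𝒯-odd-∘ h i j) ⟩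
    s i N * s h (+ 2 - (+ 2 - j) * X)        ∎
  2-[2-j]X≡2+[j-2]X : ∀ j X → + 2 - (+ 2 - j) * X ≡ + 2 + (j - + 2) * X
  2-[2-j]X≡2+[j-2]X = solve-∀
  uv-pu≡u[v-p] : ∀ u v p → u * v - p * u ≡ u * (v - p)
  uv-pu≡u[v-p] = solve-∀
  difference : s k N - p * s i N ≡ s i N * (s h (+ 2 + c) - p)
  difference = begin
    s k N - p * s i N                              ≡⟨ cong (_- p * s i N) factorisation ⟩
    s i N * s h (+ 2 - (+ 2 - j) * X) - p * s i N
      ≡⟨ cong (λ t → s i N * s h t - p * s i N) (2-[2-j]X≡2+[j-2]X j X) ⟩
    s i N * s h (+ 2 + c) - p * s i N              ≡⟨ uv-pu≡u[v-p] (s i N) (s h (+ 2 + c)) p ⟩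
    s i N * (s h (+ 2 + c) - p)                    ∎
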